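{- For all CSP processes $P,Q$: $P\sqsupseteq_{CS}^\Delta Q$ if and only if $P\sqcap Q\equiv_{CS}^\Delta Q$.
   Context: Fix a set $\Sigma$ of communications and an internal action $\tau\notin\Sigma$; $a$ ranges over $\Sigma$ and $\alpha$ over $\Sigma\cup\{\tau\}$. CSP expressions are generated by $P,Q ::= \mathrm{STOP}\mid \mathrm{div}\mid a\to P\mid P\sqcap Q\mid P\,\Box\,Q\mid P\rhd Q\mid P\,\|_A\,Q\mid P\setminus A\mid f(P)\mid P\,\triangle\,Q\mid P\,\Theta_A\,Q\mid X\mid \mu X.P$, with $A\subseteq\Sigma$, $f:\Sigma\to\Sigma$ (extended by $f(\tau)=\tau$), $X$ a process identifier. A CSP process is an expression in which every occurrence of an identifier $X$ lies within a subexpression $\mu X.P$. Transitions $P\xrightarrow{\alpha}P'$ are the least relations such that: $\mathrm{div}\xrightarrow{\tau}\mathrm{div}$; $(a\to P)\xrightarrow{a}P$; $P\sqcap Q\xrightarrow{\tau}P$, $P\sqcap Q\xrightarrow{\tau}Q$; if $P\xrightarrow{a}P'$ then $P\Box Q\xrightarrow{a}P'$, $Q\Box P\xrightarrow{a}P'$, $P\rhd Q\xrightarrow{a}P'$; if $P\xrightarrow{\tau}P'$ then $P\Box Q\xrightarrow{\tau}P'\Box Q$, $Q\Box P\xrightarrow{\tau}Q\Box P'$, $P\rhd Q\xrightarrow{\tau}P'\rhd Q$; $P\rhd Q\xrightarrow{\tau}Q$; if $P\xrightarrow{\alpha}P'$ then $f(P)\xrightarrow{f(\alpha)}f(P')$;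 if $P\xrightarrow{\alpha}P'$, $\alpha\notin A$, then $P\|_AQ\xrightarrow{\alpha}P'\|_AQ$, $Q\|_AP\xrightarrow{\alpha}Q\|_AP'$, $P\setminus A\xrightarrow{\alpha}P'\setminus A$, $P\Theta_AQ\xrightarrow{\alpha}P'\Theta_AQ$; if $P\xrightarrow{a}P'$, $Q\xrightarrow{a}Q'$, $a\in A$, then $P\|_AQ\xrightarrow{a}P'\|_AQ'$; if $P\xrightarrow{a}P'$, $a\in A$, then $P\setminus A\xrightarrow{\tau}P'\setminus A$ and $P\Theta_AQ\xrightarrow{a}Q$; if $P\xrightarrow{\alpha}P'$ then $P\triangle Q\xrightarrow{\alpha}P'\triangle Q$; if $Q\xrightarrow{\tau}Q'$ then $P\triangle Q\xrightarrow{\tau}P\triangle Q'$; if $Q\xrightarrow{a}Q'$ then $P\triangle Q\xrightarrow{a}Q'$; $\mu X.P\xrightarrow{\tau}P[\mu X.P/X]$. Write $P\Rightarrow Q$ if $P=P_0\xrightarrow{\tau}\cdots\xrightarrow{\tau}P_n=Q$ ($n\ge 0$); $P\overset{\alpha}{\Rightarrow}Q$ if $P\Rightarrow P'\xrightarrow{\alpha}Q'\Rightarrow Q$; $P\overset{\hat\alpha}{\Rightarrow}Q$ means $P\overset{\alpha}{\Rightarrow}Q$ if $\alpha\in\Sigma$ and $P\Rightarrow Q$ if $\alpha=\tau$. $P{\Uparrow}$ ($P$ diverges) if there are $P_0,P_1,\dots$ with $P\Rightarrow P_0\xrightarrow{\tau}P_1\xrightarrow{\tau}\cdots$. A coupled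 simulation is a relation $\mathcal R$ on CSP processes such that (i) if $P\mathcal RQ$ and $P\xrightarrow{\alpha}P'$ then $Q\overset{\hat\alpha}{\Rightarrow}Q'$ with $P'\mathcal RQ'$ for some $Q'$, and (ii) if $P\mathcal RQ$ then $Q\Rightarrow Q'$ with $Q'\mathcal RP$ for some $Q'$; it is divergence-preserving if $P\mathcal RQ$ and $P{\Uparrow}$ imply $Q{\Uparrow}$. $P\sqsupseteq_{CS}^\Delta Q$ (also written $Q\sqsubseteq_{CS}^\Delta P$) iff $P\mathcal RQ$ for some divergence-preserving coupled simulation $\mathcal R$; $P\equiv_{CS}^\Delta Q$ iff $P\sqsupseteq_{CS}^\Delta Q$ and $Q\sqsupseteq_{CS}^\Delta P$. -}

module Defs where

open import Data.Nat using (ℕ; zero; suc; _≟_)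
open import Data.List using (List; []; _∷_)
open import Data.List.Membership.Propositional using (_∈_)
open import Data.Product using (Σ; ∃; _×_; _,_)
open import Data.Unit using (⊤)
open import Relation.Nullary using (¬_; yes; no)

-- CSP over a set of communications Act (the paper's Σ).
-- Process identifiers are natural numbers; A ⊆ Σ is a predicate on Act.
module CSP (Act : Set) where

  data Label : Set where
    τ   : Label
    ⟨_⟩ : Act → Label

  data Expr : Set₁ where
    STOP  : Expr
    div   : Expr
    _⟶_   : Act → Expr → Expr
    _⊓_   : Expr → Expr → Expr
    _□_   : Expr → Expr → Expr
    _▷_   : Expr → Expr → Expr
    _∥[_]_ : Expr → (Act → Set) → Expr → Expr
    _∖_   : Expr → (Act → Set) → Expr
    ren   : (Act → Act) → Expr → Expr
    _△_   : Expr → Expr → Expr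
    _Θ[_]_ : Expr → (Act → Set) → Expr → Expr
    var   : ℕ → Expr
    μ     : ℕ → Expr → Expr

  relabel : (Act → Act) → Label → Label
  relabel f τ = τ
  relabel f ⟨ a ⟩ = ⟨ f a ⟩

  -- α ∉ A  (τ is never in A since τ ∉ Σ)
  _∉_ : Label → (Act → Set) → Set
  τ ∉ A = ⊤
  ⟨ a ⟩ ∉ A = ¬ A a

  data WF (bs : List ℕ) : Expr → Set₁ where
    wf-STOP : WF bs STOP
    wf-div  : WF bs div
    wf-pre  : ∀ {a P} → WF bs P → WF bs (a ⟶ P)
    wf-⊓    : ∀ {P Q} → WF bs P → WF bs Q → WF bs (P ⊓ Q)
    wf-□    : ∀ {P Q} → WF bs P → WF bs Q → WF bs (P □ Q)
    wf-▷    : ∀ {P Q} → WF bs P → WF bs Q → WF bs (P ▷ Q)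
    wf-∥    : ∀ {P A Q} → WF bs P → WF bs Q → WF bs (P ∥[ A ] Q)
    wf-∖    : ∀ {P A} → WF bs P → WF bs (P ∖ A)
    wf-ren  : ∀ {f P} → WF bs P → WF bs (ren f P)
    wf-△    : ∀ {P Q} → WF bs P → WF bs Q → WF bs (P △ Q)
    wf-Θ    : ∀ {P A Q} → WF bs P → WF bs Q → WF bs (P Θ[ A ] Q)
    wf-var  : ∀ {X} → X ∈ bs → WF bs (var X)
    wf-μ    : ∀ {X P} → WF (X ∷ bs) P → WF bs (μ X P)

  IsProcess : Expr → Set₁
  IsProcess P = WF [] P

  -- substitution P[R/X] (only used with closed R, so no capture)
  _[_/_] : Expr → Expr → ℕ → Expr
  STOP [ R / X ] = STOP
  div [ R / X ] = div
  (a ⟶ P) [ R / X ] = a ⟶ (P [ R / X ])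
  (P ⊓ Q) [ R / X ] = (P [ R / X ]) ⊓ (Q [ R / X ])
  (P □ Q) [ R / X ] = (P [ R / X ]) □ (Q [ R / X ])
  (P ▷ Q) [ R / X ] = (P [ R / X ]) ▷ (Q [ R / X ])
  (P ∥[ A ] Q) [ R / X ] = (P [ R / X ]) ∥[ A ] (Q [ R / X ])
  (P ∖ A) [ R / X ] = (P [ R / X ]) ∖ A
  ren f P [ R / X ] = ren f (P [ R / X ])
  (P △ Q) [ R / X ] = (P [ R / X ]) △ (Q [ R / X ])
  (P Θ[ A ] Q) [ R / X ] = (P [ R / X ]) Θ[ A ] (Q [ R / X ])
  var Y [ R / X ] with Y ≟ X
  ... | yes _ = R
  ... | no _ = var Y
  μ Y P [ R / X ] with Y ≟ X
  ... | yes _ = μ Y P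
  ... | no _ = μ Y (P [ R / X ])

  data _─_⟶_ : Expr → Label → Expr → Set₁ where
    div-τ   : div ─ τ ⟶ div
    pre     : ∀ {a P} → (a ⟶ P) ─ ⟨ a ⟩ ⟶ P
    ⊓-l     : ∀ {P Q} → (P ⊓ Q) ─ τ ⟶ P
    ⊓-r     : ∀ {P Q} → (P ⊓ Q) ─ τ ⟶ Q
    □-l     : ∀ {P Q a P'} → P ─ ⟨ a ⟩ ⟶ P' → (P □ Q) ─ ⟨ a ⟩ ⟶ P'
    □-r     : ∀ {P Q a P'} → P ─ ⟨ a ⟩ ⟶ P' → (Q □ P) ─ ⟨ a ⟩ ⟶ P'
    ▷-a     : ∀ {P Q a P'} → P ─ ⟨ a ⟩ ⟶ P' → (P ▷ Q) ─ ⟨ a ⟩ ⟶ P'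
    □-τl    : ∀ {P Q P'} → P ─ τ ⟶ P' → (P □ Q) ─ τ ⟶ (P' □ Q)
    □-τr    : ∀ {P Q P'} → P ─ τ ⟶ P' → (Q □ P) ─ τ ⟶ (Q □ P')
    ▷-τ     : ∀ {P Q P'} → P ─ τ ⟶ P' → (P ▷ Q) ─ τ ⟶ (P' ▷ Q)
    ▷-time  : ∀ {P Q} → (P ▷ Q) ─ τ ⟶ Q
    ren-α   : ∀ {f P α P'} → P ─ α ⟶ P' → ren f P ─ relabel f α ⟶ ren f P'
    ∥-l     : ∀ {P Q A α P'} → P ─ α ⟶ P' → α ∉ A → (P ∥[ A ] Q) ─ α ⟶ (P' ∥[ A ] Q)
    ∥-r     : ∀ {P Q A α P'} → P ─ α ⟶ P' → α ∉ A → (Q ∥[ A ] P) ─ α ⟶ (Q ∥[ A ] P')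
    ∖-α     : ∀ {P A α P'} → P ─ α ⟶ P' → α ∉ A → (P ∖ A) ─ α ⟶ (P' ∖ A)
    Θ-α     : ∀ {P Q A α P'} → P ─ α ⟶ P' → α ∉ A → (P Θ[ A ] Q) ─ α ⟶ (P' Θ[ A ] Q)
    ∥-sync  : ∀ {P Q A a P' Q'} → P ─ ⟨ a ⟩ ⟶ P' → Q ─ ⟨ a ⟩ ⟶ Q' → A a →
              (P ∥[ A ] Q) ─ ⟨ a ⟩ ⟶ (P' ∥[ A ] Q')
    ∖-hide  : ∀ {P A a P'} → P ─ ⟨ a ⟩ ⟶ P' → A a → (P ∖ A) ─ τ ⟶ (P' ∖ A)
    Θ-throw : ∀ {P Q A a P'} → P ─ ⟨ a ⟩ ⟶ P' → A a → (P Θ[ A ] Q) ─ ⟨ a ⟩ ⟶ Q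
    △-l     : ∀ {P Q α P'} → P ─ α ⟶ P' → (P △ Q) ─ α ⟶ (P' △ Q)
    △-τr    : ∀ {P Q Q'} → Q ─ τ ⟶ Q' → (P △ Q) ─ τ ⟶ (P △ Q')
    △-ar    : ∀ {P Q a Q'} → Q ─ ⟨ a ⟩ ⟶ Q' → (P △ Q) ─ ⟨ a ⟩ ⟶ Q'
    μ-unf   : ∀ {X P} → μ X P ─ τ ⟶ (P [ μ X P / X ])

  data _⇒_ : Expr → Expr → Set₁ where
    ⇒-refl : ∀ {P} → P ⇒ P
    ⇒-step : ∀ {P P' Q} → P ─ τ ⟶ P' → P' ⇒ Q → P ⇒ Q

  _=̂_⇒_ : Expr → Label → Expr → Set₁
  P =̂ τ ⇒ Q = P ⇒ Q
  P =̂ ⟨ a ⟩ ⇒ Q = ∃ λ P' → ∃ λ Q' → (P ⇒ P') × (P' ─ ⟨ a ⟩ ⟶ Q') × (Q' ⇒ Q)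

  Diverges : Expr → Set₁
  Diverges P = ∃ λ (s : ℕ → Expr) → (P ⇒ s zero) × (∀ n → s n ─ τ ⟶ s (suc n))

  record IsDPCoupledSim (R : Expr → Expr → Set₁) : Set₁ where
    field
      on-processes : ∀ {P Q} → R P Q → IsProcess P × IsProcess Q
      sim     : ∀ {P Q α P'} → R P Q → P ─ α ⟶ P' → ∃ λ Q' → (Q =̂ α ⇒ Q') × R P' Q'
      coupled : ∀ {P Q} → R P Q → ∃ λ Q' → (Q ⇒ Q') × R Q' P
      div-pres : ∀ {P Q} → R P Q → Diverges P → Diverges Q

  _⊒CS_ : Expr → Expr → Set₂
  P ⊒CS Q = Σ (Expr → Expr → Set₁) λ R → IsDPCoupledSim R × R P Q

  _≡CS_ : Expr → Expr → Set₂
  P ≡CS Q = (P ⊒CS Q) × (Q ⊒CS P)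

-- The proof rests on three facts about the relation ⊒CS on processes.
-- (1) If B ⇒ A then A ⊒CS B: B can silently reach A and afterwards mimic it.
-- (2) From P ⊒CS R and Q ⊒CS R follows P ⊓ Q ⊒CS R.
-- (3) If X ⊒CS Y and X ⇒ X' then X' ⊒CS Y, by simulating the silent path X ⇒ X'.
-- Forwards, (2) with Q ⊒CS Q gives P ⊓ Q ⊒CS Q and (1) gives Q ⊒CS P ⊓ Q;
-- backwards, (3) applied to P ⊓ Q ─τ⟶ P gives P ⊒CS Q.
module Submission where

open import Defs
open import Data.Empty using (⊥-elim)
open import Data.List using (_∷_)
open import Data.List.Membership.Propositional using (_∈_)
open import Data.List.Relation.Unary.Any using (here; there)
open import Data.Nat using (zero; suc; _≟_)
open import Data.Product using (_×_; _,_; ∃; proj₁; proj₂)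
open import Data.Sum using (_⊎_; inj₁; inj₂)
open import Function.Bundles using (_⇔_; mk⇔)
open import Relation.Binary.PropositionalEquality using (_≡_; sym; trans)
open import Relation.Nullary using (yes; no)

module Coupled (Act : Set) where
  open CSP Act

  WF-weaken : ∀ {bs bs' P} → (∀ {Y} → Y ∈ bs → Y ∈ bs') → WF bs P → WF bs' P
  WF-weaken f wf-STOP = wf-STOP
  WF-weaken f wf-div = wf-div
  WF-weaken f (wf-pre w) = wf-pre (WF-weaken f w)
  WF-weaken f (wf-⊓ w v) = wf-⊓ (WF-weaken f w) (WF-weaken f v)
  WF-weaken f (wf-□ w v) = wf-□ (WF-weaken f w) (WF-weaken f v)
  WF-weaken f (wf-▷ w v) = wf-▷ (WF-weaken f w) (WF-weaken f v)
  WF-weaken f (wf-∥ w v) = wf-∥ (WF-weaken f w) (WF-weaken f v)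
  WF-weaken f (wf-∖ w) = wf-∖ (WF-weaken f w)
  WF-weaken f (wf-ren w) = wf-ren (WF-weaken f w)
  WF-weaken f (wf-△ w v) = wf-△ (WF-weaken f w) (WF-weaken f v)
  WF-weaken f (wf-Θ w v) = wf-Θ (WF-weaken f w) (WF-weaken f v)
  WF-weaken f (wf-var m) = wf-var (f m)
  WF-weaken f (wf-μ w) = wf-μ (WF-weaken f' w)
    where
    f' : ∀ {X Z} → Z ∈ X ∷ _ → Z ∈ X ∷ _
    f' (here e) = here e
    f' (there m) = there (f m)

  WF-subst : ∀ {bs bs' P R X} → (∀ {Y} → Y ∈ bs → Y ≡ X ⊎ Y ∈ bs') →
             WF bs P → WF bs' R → WF bs' (P [ R / X ])
  WF-subst f wf-STOP wR = wf-STOP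
  WF-subst f wf-div wR = wf-div
  WF-subst f (wf-pre w) wR = wf-pre (WF-subst f w wR)
  WF-subst f (wf-⊓ w v) wR = wf-⊓ (WF-subst f w wR) (WF-subst f v wR)
  WF-subst f (wf-□ w v) wR = wf-□ (WF-subst f w wR) (WF-subst f v wR)
  WF-subst f (wf-▷ w v) wR = wf-▷ (WF-subst f w wR) (WF-subst f v wR)
  WF-subst f (wf-∥ w v) wR = wf-∥ (WF-subst f w wR) (WF-subst f v wR)
  WF-subst f (wf-∖ w) wR = wf-∖ (WF-subst f w wR)
  WF-subst f (wf-ren w) wR = wf-ren (WF-subst f w wR)
  WF-subst f (wf-△ w v) wR = wf-△ (WF-subst f w wR) (WF-subst f v wR)
  WF-subst f (wf-Θ w v) wR = wf-Θ (WF-subst f w wR) (WF-subst f v wR)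
  WF-subst {X = X} f (wf-var {Y} m) wR with Y ≟ X
  ... | yes _ = wR
  ... | no Y≢X with f m
  ...   | inj₁ Y≡X = ⊥-elim (Y≢X Y≡X)
  ...   | inj₂ m' = wf-var m'
  WF-subst {bs' = bs'} {X = X} f (wf-μ {Y} w) wR with Y ≟ X
  ... | yes Y≡X = wf-μ (WF-weaken shadowed w)
    where
    shadowed : ∀ {Z} → Z ∈ Y ∷ _ → Z ∈ Y ∷ bs'
    shadowed (here e) = here e
    shadowed (there m) with f m
    ... | inj₁ Z≡X = here (trans Z≡X (sym Y≡X))
    ... | inj₂ m' = there m'
  ... | no _ = wf-μ (WF-subst under w (WF-weaken there wR))
    where
    under : ∀ {Z} → Z ∈ Y ∷ _ → Z ≡ X ⊎ Z ∈ Y ∷ bs'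
    under (here e) = inj₂ (here e)
    under (there m) with f m
    ... | inj₁ Z≡X = inj₁ Z≡X
    ... | inj₂ m' = inj₂ (there m')

  WF-step : ∀ {bs P α P'} → WF bs P → P ─ α ⟶ P' → WF bs P'
  WF-step w div-τ = w
  WF-step (wf-pre w) pre = w
  WF-step (wf-⊓ w v) ⊓-l = w
  WF-step (wf-⊓ w v) ⊓-r = v
  WF-step (wf-□ w v) (□-l t) = WF-step w t
  WF-step (wf-□ w v) (□-r t) = WF-step v t
  WF-step (wf-▷ w v) (▷-a t) = WF-step w t
  WF-step (wf-□ w v) (□-τl t) = wf-□ (WF-step w t) v
  WF-step (wf-□ w v) (□-τr t) = wf-□ w (WF-step v t)
  WF-step (wf-▷ w v) (▷-τ t) = wf-▷ (WF-step w t) v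
  WF-step (wf-▷ w v) ▷-time = v
  WF-step (wf-ren w) (ren-α t) = wf-ren (WF-step w t)
  WF-step (wf-∥ w v) (∥-l t _) = wf-∥ (WF-step w t) v
  WF-step (wf-∥ w v) (∥-r t _) = wf-∥ w (WF-step v t)
  WF-step (wf-∖ w) (∖-α t _) = wf-∖ (WF-step w t)
  WF-step (wf-Θ w v) (Θ-α t _) = wf-Θ (WF-step w t) v
  WF-step (wf-∥ w v) (∥-sync t u _) = wf-∥ (WF-step w t) (WF-step v u)
  WF-step (wf-∖ w) (∖-hide t _) = wf-∖ (WF-step w t)
  WF-step (wf-Θ w v) (Θ-throw t _) = v
  WF-step (wf-△ w v) (△-l t) = wf-△ (WF-step w t) v
  WF-step (wf-△ w v) (△-τr t) = wf-△ w (WF-step v t)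
  WF-step (wf-△ w v) (△-ar t) = WF-step v t
  WF-step (wf-μ w) μ-unf = WF-subst unfold w (wf-μ w)
    where
    unfold : ∀ {X bs Z} → Z ∈ X ∷ bs → Z ≡ X ⊎ Z ∈ bs
    unfold (here e) = inj₁ e
    unfold (there m) = inj₂ m

  WF-⇒ : ∀ {bs P P'} → WF bs P → P ⇒ P' → WF bs P'
  WF-⇒ w ⇒-refl = w
  WF-⇒ w (⇒-step t p) = WF-⇒ (WF-step w t) p

  ⇒-trans : ∀ {A B C} → A ⇒ B → B ⇒ C → A ⇒ C
  ⇒-trans ⇒-refl q = q
  ⇒-trans (⇒-step t p) q = ⇒-step t (⇒-trans p q)

  ⇒-=̂-trans : ∀ {A B C} α → A ⇒ B → B =̂ α ⇒ C → A =̂ α ⇒ C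
  ⇒-=̂-trans τ p q = ⇒-trans p q
  ⇒-=̂-trans ⟨ a ⟩ p (B' , C' , q , t , r) = B' , C' , ⇒-trans p q , t , r

  ─⟶⇒=̂ : ∀ {A B} α → A ─ α ⟶ B → A =̂ α ⇒ B
  ─⟶⇒=̂ τ t = ⇒-step t ⇒-refl
  ─⟶⇒=̂ ⟨ a ⟩ t = _ , _ , ⇒-refl , t , ⇒-refl

  ⇒-τ-uncons : ∀ {A B C} → A ⇒ B → B ─ τ ⟶ C → ∃ λ A' → A ─ τ ⟶ A' × A' ⇒ C
  ⇒-τ-uncons ⇒-refl t = _ , t , ⇒-refl
  ⇒-τ-uncons (⇒-step u p) t = _ , u , ⇒-trans p (⇒-step t ⇒-refl)

  Diverges-⇒ : ∀ {A B} → A ⇒ B → Diverges B → Diverges A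
  Diverges-⇒ p (s , q , h) = s , ⇒-trans p q , h

  Diverges-uncons : ∀ {A} → Diverges A → ∃ λ A' → A ─ τ ⟶ A' × Diverges A'
  Diverges-uncons (s , p , h) with ⇒-τ-uncons p (h zero)
  ... | A' , t , q = A' , t , (λ n → s (suc n)) , q , (λ n → h (suc n))

  Diverges-⊓ : ∀ {P Q} → Diverges (P ⊓ Q) → Diverges P ⊎ Diverges Q
  Diverges-⊓ d with Diverges-uncons d
  ... | _ , ⊓-l , d' = inj₁ d'
  ... | _ , ⊓-r , d' = inj₂ d'

  module _ {R : Expr → Expr → Set₁} (isR : IsDPCoupledSim R) where
    open IsDPCoupledSim isR

    sim-⇒ : ∀ {A B A'} → R A B → A ⇒ A' → ∃ λ B' → B ⇒ B' × R A' B'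
    sim-⇒ r ⇒-refl = _ , ⇒-refl , r
    sim-⇒ r (⇒-step t p) with sim r t
    ... | _ , q , r₁ with sim-⇒ r₁ p
    ...   | B' , q' , r' = B' , ⇒-trans q q' , r'

  module ⇒-Sim {A B : Expr} (B-closed : IsProcess B) (B⇒A : B ⇒ A) where

    data Rel : Expr → Expr → Set₁ where
      reach : Rel A B
      id    : ∀ {C} → IsProcess C → Rel C C

    isDPCoupledSim : IsDPCoupledSim Rel
    IsDPCoupledSim.on-processes isDPCoupledSim reach = WF-⇒ B-closed B⇒A , B-closed
    IsDPCoupledSim.on-processes isDPCoupledSim (id c) = c , c
    IsDPCoupledSim.sim isDPCoupledSim {α = α} reach t =
      _ , ⇒-=̂-trans α B⇒A (─⟶⇒=̂ α t) , id (WF-step (WF-⇒ B-closed B⇒A) t)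
    IsDPCoupledSim.sim isDPCoupledSim {α = α} (id c) t = _ , ─⟶⇒=̂ α t , id (WF-step c t)
    IsDPCoupledSim.coupled isDPCoupledSim reach = A , B⇒A , id (WF-⇒ B-closed B⇒A)
    IsDPCoupledSim.coupled isDPCoupledSim (id c) = _ , ⇒-refl , id c
    IsDPCoupledSim.div-pres isDPCoupledSim reach = Diverges-⇒ B⇒A
    IsDPCoupledSim.div-pres isDPCoupledSim (id c) d = d

  ⇒⇒⊒CS : ∀ {A B} → IsProcess B → B ⇒ A → A ⊒CS B
  ⇒⇒⊒CS B-closed B⇒A = Rel , isDPCoupledSim , reach
    where open ⇒-Sim B-closed B⇒A

  ⊒CS-refl : ∀ {P} → IsProcess P → P ⊒CS P
  ⊒CS-refl P-closed = ⇒⇒⊒CS P-closed ⇒-refl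

  module ⊓-Join {P Q R : Expr} {R₁ R₂ : Expr → Expr → Set₁}
                (isR₁ : IsDPCoupledSim R₁) (isR₂ : IsDPCoupledSim R₂)
                (P≥R : R₁ P R) (Q≥R : R₂ Q R) where
    module R₁ = IsDPCoupledSim isR₁
    module R₂ = IsDPCoupledSim isR₂

    P⊓Q-closed : IsProcess (P ⊓ Q)
    P⊓Q-closed = wf-⊓ (proj₁ (R₁.on-processes P≥R)) (proj₁ (R₂.on-processes Q≥R))

    -- The back-clauses discharge the coupling obligation of choice, which needs R ⇒ R' with Rel R' (P ⊓ Q).
    data Rel : Expr → Expr → Set₁ where
      left       : ∀ {A B} → R₁ A B → Rel A B
      right      : ∀ {A B} → R₂ A B → Rel A B
      choice     : Rel (P ⊓ Q) R
      back-left  : ∀ {A} → R₁ A P → Rel A (P ⊓ Q)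
      back-right : ∀ {A} → R₂ A Q → Rel A (P ⊓ Q)

    isDPCoupledSim : IsDPCoupledSim Rel
    IsDPCoupledSim.on-processes isDPCoupledSim (left r) = R₁.on-processes r
    IsDPCoupledSim.on-processes isDPCoupledSim (right r) = R₂.on-processes r
    IsDPCoupledSim.on-processes isDPCoupledSim choice = P⊓Q-closed , proj₂ (R₁.on-processes P≥R)
    IsDPCoupledSim.on-processes isDPCoupledSim (back-left r) = proj₁ (R₁.on-processes r) , P⊓Q-closed
    IsDPCoupledSim.on-processes isDPCoupledSim (back-right r) = proj₁ (R₂.on-processes r) , P⊓Q-closed
    IsDPCoupledSim.sim isDPCoupledSim (left r) t with R₁.sim r t
    ... | B' , q , r' = B' , q , left r'
    IsDPCoupledSim.sim isDPCoupledSim (right r) t with R₂.sim r t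
    ... | B' , q , r' = B' , q , right r'
    IsDPCoupledSim.sim isDPCoupledSim choice ⊓-l = R , ⇒-refl , left P≥R
    IsDPCoupledSim.sim isDPCoupledSim choice ⊓-r = R , ⇒-refl , right Q≥R
    IsDPCoupledSim.sim isDPCoupledSim {α = α} (back-left r) t with R₁.sim r t
    ... | B' , q , r' = B' , ⇒-=̂-trans α (⇒-step ⊓-l ⇒-refl) q , left r'
    IsDPCoupledSim.sim isDPCoupledSim {α = α} (back-right r) t with R₂.sim r t
    ... | B' , q , r' = B' , ⇒-=̂-trans α (⇒-step ⊓-r ⇒-refl) q , right r'
    IsDPCoupledSim.coupled isDPCoupledSim (left r) with R₁.coupled r
    ... | B' , q , r' = B' , q , left r'
    IsDPCoupledSim.coupled isDPCoupledSim (right r) with R₂.coupled r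
    ... | B' , q , r' = B' , q , right r'
    IsDPCoupledSim.coupled isDPCoupledSim choice with R₁.coupled P≥R
    ... | R' , q , r' = R' , q , back-left r'
    IsDPCoupledSim.coupled isDPCoupledSim (back-left r) with R₁.coupled r
    ... | P' , q , r' = P' , ⇒-step ⊓-l q , left r'
    IsDPCoupledSim.coupled isDPCoupledSim (back-right r) with R₂.coupled r
    ... | Q' , q , r' = Q' , ⇒-step ⊓-r q , right r'
    IsDPCoupledSim.div-pres isDPCoupledSim (left r) = R₁.div-pres r
    IsDPCoupledSim.div-pres isDPCoupledSim (right r) = R₂.div-pres r
    IsDPCoupledSim.div-pres isDPCoupledSim choice d with Diverges-⊓ d
    ... | inj₁ dP = R₁.div-pres P≥R dP
    ... | inj₂ dQ = R₂.div-pres Q≥R dQ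
    IsDPCoupledSim.div-pres isDPCoupledSim (back-left r) d =
      Diverges-⇒ (⇒-step ⊓-l ⇒-refl) (R₁.div-pres r d)
    IsDPCoupledSim.div-pres isDPCoupledSim (back-right r) d =
      Diverges-⇒ (⇒-step ⊓-r ⇒-refl) (R₂.div-pres r d)

  ⊓-join : ∀ {P Q R} → P ⊒CS R → Q ⊒CS R → (P ⊓ Q) ⊒CS R
  ⊓-join (R₁ , isR₁ , P≥R) (R₂ , isR₂ , Q≥R) = Rel , isDPCoupledSim , choice
    where open ⊓-Join isR₁ isR₂ P≥R Q≥R

  module ⇒-Left {X X' Y : Expr} {R : Expr → Expr → Set₁}
                (isR : IsDPCoupledSim R) (X≥Y : R X Y) (X⇒X' : X ⇒ X') where
    open IsDPCoupledSim isR

    data Rel : Expr → Expr → Set₁ where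
      base    : ∀ {A B} → R A B → Rel A B
      derived : Rel X' Y

    isDPCoupledSim : IsDPCoupledSim Rel
    IsDPCoupledSim.on-processes isDPCoupledSim (base r) = on-processes r
    IsDPCoupledSim.on-processes isDPCoupledSim derived with on-processes X≥Y
    ... | X-closed , Y-closed = WF-⇒ X-closed X⇒X' , Y-closed
    IsDPCoupledSim.sim isDPCoupledSim (base r) t with sim r t
    ... | B' , q , r' = B' , q , base r'
    IsDPCoupledSim.sim isDPCoupledSim {α = α} derived t with sim-⇒ isR X≥Y X⇒X'
    ... | _ , p , r₁ with sim r₁ t
    ...   | B' , q , r' = B' , ⇒-=̂-trans α p q , base r'
    IsDPCoupledSim.coupled isDPCoupledSim (base r) with coupled r
    ... | B' , q , r' = B' , q , base r'
    IsDPCoupledSim.coupled isDPCoupledSim derived with sim-⇒ isR X≥Y X⇒X'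
    ... | _ , p , r₁ with coupled r₁
    ...   | B' , q , r' = B' , ⇒-trans p q , base r'
    IsDPCoupledSim.div-pres isDPCoupledSim (base r) = div-pres r
    IsDPCoupledSim.div-pres isDPCoupledSim derived d = div-pres X≥Y (Diverges-⇒ X⇒X' d)

  ⊒CS-⇒ : ∀ {X X' Y} → X ⊒CS Y → X ⇒ X' → X' ⊒CS Y
  ⊒CS-⇒ (R , isR , X≥Y) X⇒X' = Rel , isDPCoupledSim , derived
    where open ⇒-Left isR X≥Y X⇒X'

proposition3 : (Act : Set) → let open CSP Act in
    (P Q : Expr) → IsProcess P → IsProcess Q → (P ⊒CS Q) ⇔ ((P ⊓ Q) ≡CS Q)
proposition3 Act P Q P-closed Q-closed = mk⇔ to from
  where
  open CSP Act
  open Coupled Act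

  to : P ⊒CS Q → (P ⊓ Q) ≡CS Q
  to P≥Q = ⊓-join P≥Q (⊒CS-refl Q-closed)
         , ⇒⇒⊒CS (wf-⊓ P-closed Q-closed) (⇒-step ⊓-r ⇒-refl)

  from : (P ⊓ Q) ≡CS Q → P ⊒CS Q
  from (P⊓Q≥Q , _) = ⊒CS-⇒ P⊓Q≥Q (⇒-step ⊓-l ⇒-refl)
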